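{- Let $J$ be an arbitrary graph and let $m\ge\chi(J)$ be an integer. Then there exists a graph $G$ such that (1) $J$ is an induced subgraph of $G$, (2) $\dim_l(G)=m$, and (3) there exists a local metric basis $B$ for $G$ with $B\cap V(J)=\emptyset$.
   Context: All graphs are finite, simple and non-null. $\chi(J)$ is the chromatic number of $J$. A vertex $w$ distinguishes an edge $uv$ of $G$ if $d_G(w,u)\ne d_G(w,v)$; a local metric set of $G$ is a vertex set distinguishing every edge of $G$, a local metric basis is a local metric set of minimum cardinality, and $\dim_l(G)$ is that cardinality. -}

module Defs where

open import Data.Nat using (ℕ; zero; suc; _≤_; _<_)
open import Data.Fin using (Fin; _≟_)
open import Data.Fin.Subset using (Subset; _∈_; _∉_; ∣_∣)
open import Data.Bool using (Bool; true; false; _∨_; _∧_)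
open import Data.List using (List; allFin; upTo; findᵇ)
open import Data.Bool.ListAction using (any)
open import Data.Maybe using (Maybe)
open import Data.Product using (Σ; ∃; _×_; _,_)
open import Relation.Nullary using (¬_)
open import Relation.Nullary.Decidable using (⌊_⌋)
open import Relation.Binary.PropositionalEquality using (_≡_; _≢_)
open import Function.Definitions using (Injective)

record Graph : Set where
  field
    n       : ℕ
    nonNull : 0 < n
    adj     : Fin n → Fin n → Bool
    sym     : ∀ u v → adj u v ≡ adj v u
    irrefl  : ∀ u → adj u u ≡ false

open Graph public

V : Graph → Set
V G = Fin (n G)

reach : (G : Graph) → ℕ → V G → V G → Bool
reach G zero    u v = ⌊ u ≟ v ⌋
reach G (suc k) u v = reach G k u v ∨ any (λ w → reach G k u w ∧ adj G w v) (allFin (n G))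

-- Distance: least k with a walk of length k (just k), or nothing (= ∞) if
-- u and v lie in different components (shortest paths have length < n).
dist : (G : Graph) → V G → V G → Maybe ℕ
dist G u v = findᵇ (λ k → reach G k u v) (upTo (n G))

Distinguishes : (G : Graph) → V G → V G → V G → Set
Distinguishes G w u v = dist G w u ≢ dist G w v

IsLocalMetricSet : (G : Graph) → Subset (n G) → Set
IsLocalMetricSet G S =
  ∀ u v → adj G u v ≡ true → Σ (V G) λ w → (w ∈ S) × Distinguishes G w u v

IsLocalMetricBasis : (G : Graph) → Subset (n G) → Set
IsLocalMetricBasis G B =
  IsLocalMetricSet G B × (∀ S → IsLocalMetricSet G S → ∣ B ∣ ≤ ∣ S ∣)

LocalMetricDim≡ : Graph → ℕ → Set
LocalMetricDim≡ G m = Σ (Subset (n G)) λ B → IsLocalMetricBasis G B × ∣ B ∣ ≡ m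

Colourable : Graph → ℕ → Set
Colourable J k = Σ (V J → Fin k) λ c → ∀ u v → adj J u v ≡ true → c u ≢ c v

IsChromaticNumber : Graph → ℕ → Set
IsChromaticNumber J c = Colourable J c × (∀ k → Colourable J k → c ≤ k)

InducedEmbedding : Graph → Graph → Set
InducedEmbedding J G =
  Σ (V J → V G) λ f → Injective _≡_ _≡_ f × (∀ x y → adj J x y ≡ adj G (f x) (f y))

-- Colour J properly with colours 0, …, m-1 and attach, for every colour j, an adjacent pair of
-- twins a_j, b_j (vA j, vB j): a vertex of J with nonzero colour i is joined to a_i, b_i and to the
-- hub pair a_0, b_0, while the colour class 0 is joined to no pendant.  No third vertex can
-- distinguish a twin edge a_j b_j, so every local metric set meets each pair and has at least m
-- elements.  Conversely {a_j} resolves every edge: an edge xy of J, where c x ≠ 0 say, by a_(c x),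
-- which is adjacent to x only; an edge x b_j by a_(c x) if j = 0, and by the hub a_0 if j = c x.

module Submission where

open import Defs hiding (sym)
open import Data.Bool using (Bool; true; false; _∨_; _∧_; if_then_else_)
open import Data.Bool.Properties using (T-≡; ∨-zeroʳ)
open import Data.Bool.ListAction using (any)
open import Data.Fin using (Fin; zero; suc; _≟_; _↑ˡ_; _↑ʳ_; splitAt; join; inject≤)
open import Data.Fin.Properties using (splitAt-join; join-splitAt; inject≤-injective)
open import Data.Fin.Subset using (Subset; _∈_; _∉_; ∣_∣; ⊥; ⊤)
open import Data.Fin.Subset.Properties using (∣⊥∣≡0; ∣⊤∣≡n; ∈⊤; ∉⊥; drop-there; ∣p∣≤∣x∷p∣)
open import Data.List using ([]; _∷_; allFin; upTo; findᵇ)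
open import Data.List.Membership.Propositional using () renaming (_∈_ to _∈ₗ_)
open import Data.List.Membership.Propositional.Properties using (∈-allFin)
import Data.List.Relation.Unary.Any as Any
open import Data.List.Relation.Unary.Any.Properties using (any⁺; any⁻)
open import Data.Maybe using (just)
open import Data.Nat using (ℕ; zero; suc; _+_; _≤_; _<_; z≤n; s≤s)
open import Data.Nat.Properties
  using (≤-trans; ≤-reflexive; +-monoʳ-≤; <-≤-trans; m≤m+n; m≤n+m; +-suc; +-identityʳ; module ≤-Reasoning)
open import Data.Product using (Σ; ∃; _×_; _,_; proj₁; proj₂)
import Data.Product as Product
open import Data.Sum using (_⊎_; inj₁; inj₂; map₂; reduce)
import Data.Sum as Sum
open import Data.Sum.Properties using (inj₁-injective)
open import Data.Vec using (_∷_; _++_)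
import Data.Vec as Vec
open import Data.Vec.Properties using (lookup-++ˡ; lookup-++ʳ; []=⇒lookup; lookup⇒[]=)
open import Function using (_∘_; Equivalence)
open import Relation.Nullary using (¬_; Dec; yes; no; contradiction)
open import Relation.Nullary.Decidable using (⌊_⌋; isYes≗does; dec-true; dec-false; toWitness)
open import Relation.Binary.PropositionalEquality
  using (_≡_; _≢_; refl; sym; trans; cong; cong₂; subst; subst₂; ≢-sym; module ≡-Reasoning)

open Equivalence using (to; from)

∨-true⁻ : ∀ {a b} → a ∨ b ≡ true → a ≡ true ⊎ b ≡ true
∨-true⁻ {true}  _ = inj₁ refl
∨-true⁻ {false} e = inj₂ e

∧-true⁻ : ∀ {a b} → a ∧ b ≡ true → a ≡ true × b ≡ true
∧-true⁻ {true} {true} _ = refl , refl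

≡-true-ext : ∀ {a b} → (a ≡ true → b ≡ true) → (b ≡ true → a ≡ true) → a ≡ b
≡-true-ext {true}          f _ = sym (f refl)
≡-true-ext {false} {true}  _ g = g refl
≡-true-ext {false} {false} _ _ = refl

any-true⁻ : ∀ {A : Set} (p : A → Bool) xs → any p xs ≡ true → ∃ λ x → p x ≡ true
any-true⁻ p xs e = Product.map₂ (to T-≡) (Any.satisfied (any⁻ p xs (from T-≡ e)))

any-true⁺ : ∀ {A : Set} (p : A → Bool) {x xs} → x ∈ₗ xs → p x ≡ true → any p xs ≡ true
any-true⁺ p x∈xs px = to T-≡ (any⁺ p (Any.map (λ { refl → from T-≡ px }) x∈xs))

⌊⌋-true⁺ : ∀ {A : Set} (a? : Dec A) → A → ⌊ a? ⌋ ≡ true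
⌊⌋-true⁺ a? a = trans (isYes≗does a?) (dec-true a? a)

⌊⌋-false⁺ : ∀ {A : Set} (a? : Dec A) → ¬ A → ⌊ a? ⌋ ≡ false
⌊⌋-false⁺ a? ¬a = trans (isYes≗does a?) (dec-false a? ¬a)

⌊⌋-true⁻ : ∀ {A : Set} {a? : Dec A} → ⌊ a? ⌋ ≡ true → A
⌊⌋-true⁻ e = toWitness (from T-≡ e)

findᵇ-just⁻ : (p : ℕ → Bool) → ∀ xs {k} → findᵇ p xs ≡ just k → p k ≡ true
findᵇ-just⁻ p (x ∷ xs) e with p x in px
findᵇ-just⁻ p (x ∷ xs) refl | true  = px
...                         | false = findᵇ-just⁻ p xs e

findᵇ-cong : (p q : ℕ → Bool) → ∀ xs → (∀ k → p k ≡ q k) → findᵇ p xs ≡ findᵇ q xs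
findᵇ-cong p q [] p≗q = refl
findᵇ-cong p q (x ∷ xs) p≗q rewrite p≗q x with q x
... | true  = refl
... | false = findᵇ-cong p q xs p≗q

findᵇ-upTo-zero : (p : ℕ → Bool) → ∀ {N} → 0 < N → p 0 ≡ true → findᵇ p (upTo N) ≡ just 0
findᵇ-upTo-zero p (s≤s _) p0 rewrite p0 = refl

findᵇ-upTo-one : (p : ℕ → Bool) → ∀ {N} → 1 < N → p 0 ≡ false → p 1 ≡ true → findᵇ p (upTo N) ≡ just 1
findᵇ-upTo-one p (s≤s (s≤s _)) p0 p1 rewrite p0 | p1 = refl

≢⇒1<n : ∀ {k} {i j : Fin k} → i ≢ j → 1 < k
≢⇒1<n {suc zero}    {zero} {zero} i≢j = contradiction refl i≢j
≢⇒1<n {suc (suc k)}               _   = s≤s (s≤s z≤n)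

Twins : (G : Graph) → V G → V G → Set
Twins G a b = ∀ u → u ≢ a → u ≢ b → adj G u a ≡ adj G u b

module _ (G : Graph) where

  adj⇒≢ : ∀ {u v} → adj G u v ≡ true → u ≢ v
  adj⇒≢ {u} a refl with trans (sym a) (irrefl G u)
  ... | ()

  reach-zero⁻ : ∀ {u v} → reach G 0 u v ≡ true → u ≡ v
  reach-zero⁻ = ⌊⌋-true⁻

  reach-suc⁺ : ∀ k u {v} → reach G k u v ≡ true → reach G (suc k) u v ≡ true
  reach-suc⁺ k u r rewrite r = refl

  reach-step⁺ : ∀ k u {w v} → reach G k u w ≡ true → adj G w v ≡ true → reach G (suc k) u v ≡ true
  reach-step⁺ k u {w} {v} r a
    rewrite any-true⁺ (λ x → reach G k u x ∧ adj G x v) {xs = allFin (n G)} (∈-allFin w) (cong₂ _∧_ r a)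
    = ∨-zeroʳ _

  reach-suc⁻ : ∀ k u {v} → reach G (suc k) u v ≡ true →
    reach G k u v ≡ true ⊎ ∃ λ w → reach G k u w ≡ true × adj G w v ≡ true
  reach-suc⁻ k u r with ∨-true⁻ r
  ... | inj₁ r′ = inj₁ r′
  ... | inj₂ s  = inj₂ (Product.map₂ ∧-true⁻ (any-true⁻ _ (allFin (n G)) s))

  reach-one⁻ : ∀ {u v} → reach G 1 u v ≡ true → u ≡ v ⊎ adj G u v ≡ true
  reach-one⁻ {u} r with reach-suc⁻ 0 u r
  ... | inj₁ r′ = inj₁ (reach-zero⁻ r′)
  ... | inj₂ (w , r′ , a) with reach-zero⁻ {u} {w} r′
  ... | refl = inj₂ a

  dist-just⁻ : ∀ {u v k} → dist G u v ≡ just k → reach G k u v ≡ true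
  dist-just⁻ = findᵇ-just⁻ _ (upTo (n G))

  dist-refl : ∀ {u} → dist G u u ≡ just 0
  dist-refl {u} = findᵇ-upTo-zero _ (nonNull G) (⌊⌋-true⁺ (u ≟ u) refl)

  dist-adjacent : ∀ {u v} → adj G u v ≡ true → dist G u v ≡ just 1
  dist-adjacent {u} {v} a = findᵇ-upTo-one _ (≢⇒1<n (adj⇒≢ a)) (⌊⌋-false⁺ (u ≟ v) (adj⇒≢ a))
    (reach-step⁺ 0 u (⌊⌋-true⁺ (u ≟ u) refl) a)

  self-distinguishes : ∀ {u v} → u ≢ v → Distinguishes G u u v
  self-distinguishes u≢v d = u≢v (reach-zero⁻ (dist-just⁻ (trans (sym d) dist-refl)))

  neighbour-distinguishes : ∀ {w u v} → adj G w u ≡ true → adj G w v ≡ false → Distinguishes G w u v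
  neighbour-distinguishes wu wv d with reach-one⁻ (dist-just⁻ (trans (sym d) (dist-adjacent wu)))
  ... | inj₂ a = contradiction (trans (sym a) wv) λ ()
  ... | inj₁ refl with trans (sym (dist-adjacent wu)) (trans d dist-refl)
  ... | ()

  twins-sym : ∀ {a b} → Twins G a b → Twins G b a
  twins-sym t u u≢b u≢a = sym (t u u≢a u≢b)

  twins-reach : ∀ {a b w} → Twins G a b → w ≢ a → w ≢ b →
    ∀ k → reach G k w a ≡ true → reach G k w b ≡ true
  twins-reach t w≢a w≢b zero r = contradiction (reach-zero⁻ r) w≢a
  twins-reach {a} {b} {w} t w≢a w≢b (suc k) r with reach-suc⁻ k w r
  ... | inj₁ r′ = reach-suc⁺ k w (twins-reach t w≢a w≢b k r′)
  ... | inj₂ (u , r′ , ua) with u ≟ a | u ≟ b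
  ...   | yes refl | _        = contradiction refl (adj⇒≢ ua)
  ...   | no _     | yes refl = reach-suc⁺ k w r′
  ...   | no u≢a   | no u≢b   = reach-step⁺ k w r′ (trans (sym (t u u≢a u≢b)) ua)

  twins-equidistant : ∀ {a b w} → Twins G a b → w ≢ a → w ≢ b → dist G w a ≡ dist G w b
  twins-equidistant t w≢a w≢b = findᵇ-cong _ _ (upTo (n G)) λ k →
    ≡-true-ext (twins-reach t w≢a w≢b k) (twins-reach (twins-sym t) w≢b w≢a k)

  twins-meet-local-metric-set : ∀ {a b S} → Twins G a b → adj G a b ≡ true →
    IsLocalMetricSet G S → a ∈ S ⊎ b ∈ S
  twins-meet-local-metric-set {a} {b} t ab lms with lms a b ab
  ... | w , w∈S , d with w ≟ a | w ≟ b
  ...   | yes refl | _        = inj₁ w∈S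
  ...   | no _     | yes refl = inj₂ w∈S
  ...   | no w≢a   | no w≢b   = contradiction (twins-equidistant t w≢a w≢b) d

∣p++q∣≡∣p∣+∣q∣ : ∀ {a b} (p : Subset a) (q : Subset b) → ∣ p ++ q ∣ ≡ ∣ p ∣ + ∣ q ∣
∣p++q∣≡∣p∣+∣q∣ Vec.[]      q = refl
∣p++q∣≡∣p∣+∣q∣ (true ∷ p)  q = cong suc (∣p++q∣≡∣p∣+∣q∣ p q)
∣p++q∣≡∣p∣+∣q∣ (false ∷ p) q = ∣p++q∣≡∣p∣+∣q∣ p q

module _ {a b} (p : Subset a) (q : Subset b) where

  ∈-++⁺ˡ : ∀ {i} → i ∈ p → i ↑ˡ b ∈ p ++ q
  ∈-++⁺ˡ {i} i∈p = lookup⇒[]= _ (p ++ q) (trans (lookup-++ˡ p q i) ([]=⇒lookup i∈p))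

  ∈-++⁻ˡ : ∀ {i} → i ↑ˡ b ∈ p ++ q → i ∈ p
  ∈-++⁻ˡ {i} i∈p++q = lookup⇒[]= i p (trans (sym (lookup-++ˡ p q i)) ([]=⇒lookup i∈p++q))

  ∈-++⁺ʳ : ∀ {j} → j ∈ q → a ↑ʳ j ∈ p ++ q
  ∈-++⁺ʳ {j} j∈q = lookup⇒[]= _ (p ++ q) (trans (lookup-++ʳ p q j) ([]=⇒lookup j∈q))

  ∈-++⁻ʳ : ∀ {j} → a ↑ʳ j ∈ p ++ q → j ∈ q
  ∈-++⁻ʳ {j} j∈p++q = lookup⇒[]= j q (trans (sym (lookup-++ʳ p q j)) ([]=⇒lookup j∈p++q))

covering⇒≤∣p∣+∣q∣ : ∀ {k} (p q : Subset k) → (∀ j → j ∈ p ⊎ j ∈ q) → k ≤ ∣ p ∣ + ∣ q ∣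
covering⇒≤∣p∣+∣q∣ Vec.[] Vec.[] _ = z≤n
covering⇒≤∣p∣+∣q∣ (x ∷ p) (y ∷ q) cover with covering⇒≤∣p∣+∣q∣ p q (Sum.map drop-there drop-there ∘ cover ∘ suc)
... | k≤ with x | y | cover zero
...   | true  | y     | _      = s≤s (≤-trans k≤ (+-monoʳ-≤ ∣ p ∣ (∣p∣≤∣x∷p∣ y q)))
...   | false | true  | _      = ≤-trans (s≤s k≤) (≤-reflexive (sym (+-suc ∣ p ∣ ∣ q ∣)))
...   | false | false | inj₁ ()
...   | false | false | inj₂ ()

colourable-≤ : ∀ {J k m} → k ≤ m → Colourable J k → Colourable J m
colourable-≤ k≤m (c , proper) =
  (λ x → inject≤ (c x) k≤m) , λ x y xy eq → proper x y xy (inject≤-injective k≤m k≤m _ _ eq)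

map₂-inverse : ∀ {A B C : Set} {f : B → C} {g : C → B} →
  (∀ y → g (f y) ≡ y) → (s : A ⊎ B) → map₂ g (map₂ f s) ≡ s
map₂-inverse g∘f≗id (inj₁ x) = refl
map₂-inverse g∘f≗id (inj₂ y) = cong inj₂ (g∘f≗id y)

isZero : ∀ {k} → Fin k → Bool
isZero zero    = true
isZero (suc _) = false

zeroOf : ∀ {k} → Fin k → Fin k
zeroOf zero    = zero
zeroOf (suc _) = zero

isZero-zeroOf : ∀ {k} (i : Fin k) → isZero (zeroOf i) ≡ true
isZero-zeroOf zero    = refl
isZero-zeroOf (suc _) = refl

isZero-unique : ∀ {k} {i j : Fin k} → isZero i ≡ true → isZero j ≡ true → i ≡ j
isZero-unique {i = zero} {zero} _ _ = refl

isZero-≢ : ∀ {k} {i j : Fin k} → isZero i ≡ true → isZero j ≡ false → i ≢ j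
isZero-≢ zi zj refl with trans (sym zi) zj
... | ()

⌊≟⌋-sym : ∀ {k} (i j : Fin k) → ⌊ i ≟ j ⌋ ≡ ⌊ j ≟ i ⌋
⌊≟⌋-sym i j with i ≟ j | j ≟ i
... | yes _   | yes _   = refl
... | no _    | no _    = refl
... | yes i≡j | no j≢i  = contradiction (sym i≡j) j≢i
... | no i≢j  | yes j≡i = contradiction (sym j≡i) i≢j

Resolves : (G : Graph) → Subset (n G) → V G → V G → Set
Resolves G S u v = Σ (V G) λ w → w ∈ S × Distinguishes G w u v

resolves-sym : ∀ {G S u v} → Resolves G S u v → Resolves G S v u
resolves-sym (w , w∈S , d) = w , w∈S , d ∘ sym

module PendantExtension (J : Graph) {m : ℕ} (colouring : Colourable J m) where

  c : V J → Fin m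
  c = proj₁ colouring

  proper : ∀ x y → adj J x y ≡ true → c x ≢ c y
  proper = proj₂ colouring

  attached : V J → Fin m → Bool
  attached x j = if isZero (c x) then false else (isZero j ∨ ⌊ j ≟ c x ⌋)

  Vertex : Set
  Vertex = V J ⊎ (Fin m ⊎ Fin m)

  pattern vJ x = inj₁ x
  pattern vA j = inj₂ (inj₁ j)
  pattern vB j = inj₂ (inj₂ j)

  adjV : Vertex → Vertex → Bool
  adjV (vJ x)   (vJ y)   = adj J x y
  adjV (vJ x)   (inj₂ s) = attached x (reduce s)
  adjV (inj₂ s) (vJ x)   = attached x (reduce s)
  adjV (vA i)   (vB j)   = ⌊ i ≟ j ⌋
  adjV (vB i)   (vA j)   = ⌊ i ≟ j ⌋
  adjV (vA _)   (vA _)   = false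
  adjV (vB _)   (vB _)   = false

  adjV-sym : ∀ v w → adjV v w ≡ adjV w v
  adjV-sym (vJ x)   (vJ y)   = Graph.sym J x y
  adjV-sym (vJ _)   (inj₂ _) = refl
  adjV-sym (inj₂ _) (vJ _)   = refl
  adjV-sym (vA i)   (vB j)   = ⌊≟⌋-sym i j
  adjV-sym (vB i)   (vA j)   = ⌊≟⌋-sym i j
  adjV-sym (vA _)   (vA _)   = refl
  adjV-sym (vB _)   (vB _)   = refl

  adjV-irrefl : ∀ v → adjV v v ≡ false
  adjV-irrefl (vJ x) = irrefl J x
  adjV-irrefl (vA _) = refl
  adjV-irrefl (vB _) = refl

  encode : Vertex → Fin (n J + (m + m))
  encode = join (n J) (m + m) ∘ map₂ (join m m)

  decode : Fin (n J + (m + m)) → Vertex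
  decode = map₂ (splitAt m) ∘ splitAt (n J)

  decode-encode : ∀ v → decode (encode v) ≡ v
  decode-encode v = trans (cong (map₂ (splitAt m)) (splitAt-join (n J) (m + m) (map₂ (join m m) v)))
                          (map₂-inverse (splitAt-join m m) v)

  encode-decode : ∀ u → encode (decode u) ≡ u
  encode-decode u = trans (cong (join (n J) (m + m)) (map₂-inverse (join-splitAt m m) (splitAt (n J) u)))
                          (join-splitAt (n J) (m + m) u)

  encode-injective : ∀ {v w} → encode v ≡ encode w → v ≡ w
  encode-injective {v} {w} e = trans (sym (decode-encode v)) (trans (cong decode e) (decode-encode w))

  G : Graph
  G = record
    { n       = n J + (m + m)
    ; nonNull = <-≤-trans (nonNull J) (m≤m+n (n J) (m + m))
    ; adj     = λ u v → adjV (decode u) (decode v)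
    ; sym     = λ u v → adjV-sym (decode u) (decode v)
    ; irrefl  = λ u → adjV-irrefl (decode u)
    }

  adj-encode : ∀ v w → adj G (encode v) (encode w) ≡ adjV v w
  adj-encode v w = cong₂ adjV (decode-encode v) (decode-encode w)

  embedding : InducedEmbedding J G
  embedding = encode ∘ vJ , inj₁-injective ∘ encode-injective , λ x y → sym (adj-encode (vJ x) (vJ y))

  decode-≢ : ∀ {u v} → u ≢ encode v → decode u ≢ v
  decode-≢ {u} u≢v refl = u≢v (sym (encode-decode u))

  pendants-twins : ∀ j → Twins G (encode (vA j)) (encode (vB j))
  pendants-twins j u u≢a u≢b = begin
    adj G u (encode (vA j))  ≡⟨ cong (adjV (decode u)) (decode-encode (vA j)) ⟩
    adjV (decode u) (vA j)   ≡⟨ same-attachment (decode u) (decode-≢ u≢a) (decode-≢ u≢b) ⟩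
    adjV (decode u) (vB j)   ≡⟨ cong (adjV (decode u)) (decode-encode (vB j)) ⟨
    adj G u (encode (vB j))  ∎
    where
    open ≡-Reasoning
    same-attachment : ∀ v → v ≢ vA j → v ≢ vB j → adjV v (vA j) ≡ adjV v (vB j)
    same-attachment (vJ _) _   _   = refl
    same-attachment (vA i) i≢j _   = sym (⌊⌋-false⁺ (i ≟ j) (i≢j ∘ cong vA))
    same-attachment (vB i) _   i≢j = ⌊⌋-false⁺ (i ≟ j) (i≢j ∘ cong vB)

  pendants-adjacent : ∀ j → adj G (encode (vA j)) (encode (vB j)) ≡ true
  pendants-adjacent j = trans (adj-encode (vA j) (vB j)) (⌊⌋-true⁺ (j ≟ j) refl)

  local-metric-set-bound : ∀ {S} → IsLocalMetricSet G S → m ≤ ∣ S ∣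
  local-metric-set-bound {S} lms with Vec.splitAt (n J) S
  ... | S₁ , S′ , refl with Vec.splitAt m S′
  ... | S₂ , S₃ , refl = begin
    m                         ≤⟨ covering⇒≤∣p∣+∣q∣ S₂ S₃ cover ⟩
    ∣ S₂ ∣ + ∣ S₃ ∣           ≡⟨ ∣p++q∣≡∣p∣+∣q∣ S₂ S₃ ⟨
    ∣ S₂ ++ S₃ ∣              ≤⟨ m≤n+m _ ∣ S₁ ∣ ⟩
    ∣ S₁ ∣ + ∣ S₂ ++ S₃ ∣     ≡⟨ ∣p++q∣≡∣p∣+∣q∣ S₁ (S₂ ++ S₃) ⟨
    ∣ S₁ ++ (S₂ ++ S₃) ∣      ∎
    where
    open ≤-Reasoning
    cover : ∀ j → j ∈ S₂ ⊎ j ∈ S₃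
    cover j = Sum.map (∈-++⁻ˡ S₂ S₃ ∘ ∈-++⁻ʳ S₁ (S₂ ++ S₃)) (∈-++⁻ʳ S₂ S₃ ∘ ∈-++⁻ʳ S₁ (S₂ ++ S₃))
      (twins-meet-local-metric-set G (pendants-twins j) (pendants-adjacent j) lms)

  B : Subset (n G)
  B = ⊥ {n J} ++ (⊤ {m} ++ ⊥ {m})

  ∣B∣≡m : ∣ B ∣ ≡ m
  ∣B∣≡m = begin
    ∣ B ∣                              ≡⟨ ∣p++q∣≡∣p∣+∣q∣ (⊥ {n J}) (⊤ {m} ++ ⊥ {m}) ⟩
    ∣ ⊥ {n J} ∣ + ∣ ⊤ {m} ++ ⊥ {m} ∣   ≡⟨ cong₂ _+_ (∣⊥∣≡0 (n J)) (∣p++q∣≡∣p∣+∣q∣ (⊤ {m}) (⊥ {m})) ⟩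
    0 + (∣ ⊤ {m} ∣ + ∣ ⊥ {m} ∣)        ≡⟨ cong₂ _+_ (∣⊤∣≡n m) (∣⊥∣≡0 m) ⟩
    m + 0                              ≡⟨ +-identityʳ m ⟩
    m                                  ∎
    where open ≡-Reasoning

  vA∈B : ∀ j → encode (vA j) ∈ B
  vA∈B j = ∈-++⁺ʳ (⊥ {n J}) (⊤ {m} ++ ⊥ {m}) (∈-++⁺ˡ (⊤ {m}) (⊥ {m}) ∈⊤)

  vJ∉B : ∀ x → encode (vJ x) ∉ B
  vJ∉B x = ∉⊥ ∘ ∈-++⁻ˡ (⊥ {n J}) (⊤ {m} ++ ⊥ {m})

  attached-own : ∀ {x} → isZero (c x) ≡ false → attached x (c x) ≡ true
  attached-own {x} cx≢0 rewrite cx≢0 = ⌊⌋-true⁺ (c x ≟ c x) refl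

  attached-hub : ∀ {x j} → isZero (c x) ≡ false → isZero j ≡ true → attached x j ≡ true
  attached-hub cx≢0 j≡0 rewrite cx≢0 | j≡0 = refl

  attached-other : ∀ {y j} → isZero j ≡ false → j ≢ c y → attached y j ≡ false
  attached-other {y} {j} j≢0 j≢cy with isZero (c y)
  ... | true  = refl
  ... | false rewrite j≢0 = ⌊⌋-false⁺ (j ≟ c y) j≢cy

  attached⁻ : ∀ {x j} → attached x j ≡ true → isZero (c x) ≡ false × (isZero j ≡ true ⊎ j ≡ c x)
  attached⁻ {x} {j} e with isZero (c x)
  ... | false with ∨-true⁻ e
  ...   | inj₁ j≡0  = refl , inj₁ j≡0
  ...   | inj₂ j≡cx = refl , inj₂ (⌊⌋-true⁻ j≡cx)

  separated-by-vA : ∀ j v w → adjV (vA j) v ≡ true → adjV (vA j) w ≡ false →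
    Resolves G B (encode v) (encode w)
  separated-by-vA j v w p q = encode (vA j) , vA∈B j ,
    neighbour-distinguishes G (trans (adj-encode (vA j) v) p) (trans (adj-encode (vA j) w) q)

  resolved-by-vA : ∀ j {w} → w ≢ vA j → Resolves G B (encode (vA j)) (encode w)
  resolved-by-vA j w≢vA = encode (vA j) , vA∈B j , self-distinguishes G (w≢vA ∘ sym ∘ encode-injective)

  J-edge-resolved : ∀ {x y} → c x ≢ c y → isZero (c x) ≡ false →
    Resolves G B (encode (vJ x)) (encode (vJ y))
  J-edge-resolved {x} {y} cx≢cy cx≢0 =
    separated-by-vA (c x) (vJ x) (vJ y) (attached-own {x} cx≢0) (attached-other {y} cx≢0 cx≢cy)

  vB-edge-resolved : ∀ {x j} → attached x j ≡ true → Resolves G B (encode (vJ x)) (encode (vB j))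
  vB-edge-resolved {x} {j} e with attached⁻ e
  ... | cx≢0 , inj₁ j≡0  = separated-by-vA (c x) (vJ x) (vB j) (attached-own {x} cx≢0)
                             (⌊⌋-false⁺ (c x ≟ j) (≢-sym (isZero-≢ j≡0 cx≢0)))
  ... | cx≢0 , inj₂ refl = separated-by-vA (zeroOf j) (vJ x) (vB j) (attached-hub {x} cx≢0 (isZero-zeroOf j))
                             (⌊⌋-false⁺ (zeroOf j ≟ j) (isZero-≢ (isZero-zeroOf j) cx≢0))

  B-resolves : ∀ v w → adjV v w ≡ true → Resolves G B (encode v) (encode w)
  B-resolves (vJ x) (vJ y) e with isZero (c x) in cx | isZero (c y) in cy
  ... | false | _     = J-edge-resolved (proper x y e) cx
  ... | true  | false = resolves-sym (J-edge-resolved (proper y x (trans (Graph.sym J y x) e)) cy)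
  ... | true  | true  = contradiction (isZero-unique cx cy) (proper x y e)
  B-resolves (vJ x) (vA j) _ = resolves-sym (resolved-by-vA j {vJ x} λ ())
  B-resolves (vA j) (vJ x) _ = resolved-by-vA j {vJ x} λ ()
  B-resolves (vJ x) (vB j) e = vB-edge-resolved {x} {j} e
  B-resolves (vB j) (vJ x) e = resolves-sym (vB-edge-resolved {x} {j} e)
  B-resolves (vA i) (vB j) _ = resolved-by-vA i {vB j} λ ()
  B-resolves (vB i) (vA j) _ = resolves-sym (resolved-by-vA j {vB i} λ ())

  B-isLocalMetricSet : IsLocalMetricSet G B
  B-isLocalMetricSet u v e =
    subst₂ (Resolves G B) (encode-decode u) (encode-decode v) (B-resolves (decode u) (decode v) e)

  B-isLocalMetricBasis : IsLocalMetricBasis G B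
  B-isLocalMetricBasis =
    B-isLocalMetricSet , λ S lms → subst (_≤ ∣ S ∣) (sym ∣B∣≡m) (local-metric-set-bound lms)

lemma8 : (J : Graph) (χ m : ℕ) → IsChromaticNumber J χ → χ ≤ m →
    Σ Graph λ G → Σ (InducedEmbedding J G) λ e →
      LocalMetricDim≡ G m ×
      Σ (Subset (n G)) λ B → IsLocalMetricBasis G B × (∀ x → proj₁ e x ∉ B)
lemma8 J χ m (χ-colourable , _) χ≤m =
  G , embedding , (B , B-isLocalMetricBasis , ∣B∣≡m) , B , B-isLocalMetricBasis , vJ∉B
  where open PendantExtension J (colourable-≤ {J} χ≤m χ-colourable)
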